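{- Let $p>3$ be a prime, $n\ge1$, and $M=(a_{i,j})\in M^{n\times n}(\mathbb{F}_p)$ nonsingular. The property "there is no $x\in\mathbb{F}_p^n$ with $x_i\ne0$ and $\sum_ja_{i,j}x_j\neq0$ for all $i\in[n]$" is equivalent to $$\Big\langle\prod_{1\le i\le n}\Big(\sum_{1\le j\le n}a_{i,j}x_j\Big)^{r_i},\ \prod_{1\le i\le n}x_i^{s_i}\Big\rangle=0\quad\text{for all }1\le r_i,s_i\le p-1\ (i\in[n]).$$ In particular, under this property, if $1\le r_i\le p-1$, $0\le s'_i\le p-2$ and $\sum_ir_i=\sum_is'_i$, then $$\mathrm{Coeff}\Big(\prod_ix_i^{s'_i},\ \overline{\prod_i\Big(\sum_ja_{i,j}x_j\Big)^{r_i}}\Big)=0.$$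
   Context: For functions $u,w:\mathbb{F}_p^n\to\mathbb{F}_p$ (in particular polynomial functions), $\langle u,w\rangle=\sum_{x\in\mathbb{F}_p^n}u(x)w(x)\in\mathbb{F}_p$. For $f\in\mathbb{F}_p[x_1,\dots,x_n]$, $\overline f$ is its reduced form (degree $\le p-1$ in each variable, obtained by replacing $x^{i(p-1)+j}$ by $x^j$ when $i>0$, $0<j<p$), and $\mathrm{Coeff}(\prod x_i^{b_i},f)$ denotes the coefficient of that monomial in $f$. -}

module Defs where

open import Data.Nat as ℕ using (ℕ; zero; suc; NonZero; _≤ᵇ_)
open import Data.Nat.DivMod using (_mod_)
open import Data.Fin as Fin using (Fin; toℕ; punchIn)
open import Data.Fin.Properties using () renaming (_≟_ to _≟F_)
open import Data.Bool using (if_then_else_)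
open import Data.List as List using (List; []; _∷_; _++_; concatMap; foldr; allFin)
open import Data.Vec as Vec using (Vec; tabulate; zipWith; replicate)
open import Data.Vec.Properties using (≡-dec)
import Data.Vec.Functional as VF
open import Data.Product using (Σ; _×_; _,_)
open import Relation.Binary.PropositionalEquality using (_≡_)
open import Relation.Nullary using (yes; no; ¬_)
open import Relation.Nullary.Decidable using (⌊_⌋)

module FF (p : ℕ) .{{_ : NonZero p}} where

  F : Set
  F = Fin p

  0F 1F : F
  0F = 0 mod p
  1F = 1 mod p

  _+F_ _*F_ : F → F → F
  a +F b = (toℕ a ℕ.+ toℕ b) mod p
  a *F b = (toℕ a ℕ.* toℕ b) mod p

  -F_ : F → F
  -F a = (p ℕ.∸ toℕ a) mod p

  _^F_ : F → ℕ → F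
  a ^F zero = 1F
  a ^F suc k = a *F (a ^F k)

  sumL : List F → F
  sumL = foldr _+F_ 0F

  ΣF : (n : ℕ) → (Fin n → F) → F
  ΣF n f = sumL (List.map f (allFin n))

  ΠF : (n : ℕ) → (Fin n → F) → F
  ΠF n f = foldr _*F_ 1F (List.map f (allFin n))

  allPts : (n : ℕ) → List (Fin n → F)
  allPts zero = (λ ()) ∷ []
  allPts (suc n) =
    concatMap (λ a → List.map (λ v → a VF.∷ v) (allPts n)) (allFin p)

  inner : {n : ℕ} → ((Fin n → F) → F) → ((Fin n → F) → F) → F
  inner {n} u w = sumL (List.map (λ x → u x *F w x) (allPts n))

  det : {n : ℕ} → (Fin n → Fin n → F) → F
  det {zero} M = 1F
  det {suc n} M = ΣF (suc n) λ j →
    ((-F 1F) ^F toℕ j) *F (M Fin.zero j *F det {n} (λ i k → M (Fin.suc i) (punchIn j k)))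

  Nonsingular : {n : ℕ} → (Fin n → Fin n → F) → Set
  Nonsingular M = ¬ (det M ≡ 0F)

  linF : {n : ℕ} → (Fin n → Fin n → F) → (Fin n → F) → Fin n → F
  linF {n} A x i = ΣF n (λ j → A i j *F x j)

  prodLinFn : {n : ℕ} → (Fin n → Fin n → F) → (Fin n → ℕ) → (Fin n → F) → F
  prodLinFn {n} A r x = ΠF n (λ i → linF A x i ^F r i)

  monoFn : {n : ℕ} → (Fin n → ℕ) → (Fin n → F) → F
  monoFn {n} s x = ΠF n (λ i → x i ^F s i)

  -- Polynomials in F_p[x_1..x_n] as formal sums of terms (coefficient, exponent vector)
  Poly : ℕ → Set
  Poly n = List (F × Vec ℕ n)

  pconst : {n : ℕ} → F → Poly n
  pconst {n} c = (c , replicate n 0) ∷ []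

  pvar : {n : ℕ} → Fin n → Poly n
  pvar j = (1F , tabulate (λ k → if ⌊ k ≟F j ⌋ then 1 else 0)) ∷ []

  _+P_ : {n : ℕ} → Poly n → Poly n → Poly n
  f +P g = f ++ g

  _*P_ : {n : ℕ} → Poly n → Poly n → Poly n
  f *P g = concatMap (λ { (c , e) → List.map (λ { (d , e') → (c *F d , zipWith ℕ._+_ e e') }) g }) f

  scaleP : {n : ℕ} → F → Poly n → Poly n
  scaleP c f = List.map (λ { (d , e) → (c *F d , e) }) f

  _^P_ : {n : ℕ} → Poly n → ℕ → Poly n
  f ^P zero = pconst 1F
  f ^P suc k = f *P (f ^P k)

  linP : {n : ℕ} → (Fin n → Fin n → F) → Fin n → Poly n
  linP {n} A i = foldr _+P_ [] (List.map (λ j → scaleP (A i j) (pvar j)) (allFin n))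

  prodLinP : {n : ℕ} → (Fin n → Fin n → F) → (Fin n → ℕ) → Poly n
  prodLinP {n} A r = foldr _*P_ (pconst 1F) (List.map (λ i → linP A i ^P r i) (allFin n))

  -- reduction of an exponent: x^{i(p-1)+j} ↦ x^j  (i > 0, 0 < j < p), i.e.
  -- repeatedly replace e by e - (p-1) while e ≥ p (e iterations always suffice).
  redStep : ℕ → ℕ
  redStep e = if p ≤ᵇ e then e ℕ.∸ (p ℕ.∸ 1) else e

  iter : ℕ → (ℕ → ℕ) → ℕ → ℕ
  iter zero f x = x
  iter (suc k) f x = f (iter k f x)

  redExp : ℕ → ℕ
  redExp e = iter e redStep e

  reduce : {n : ℕ} → Poly n → Poly n
  reduce f = List.map (λ { (c , e) → (c , Vec.map redExp e) }) f

  Coeff : {n : ℕ} → Vec ℕ n → Poly n → F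
  Coeff m [] = 0F
  Coeff m ((c , e) ∷ f) with ≡-dec ℕ._≟_ e m
  ... | yes _ = c +F Coeff m f
  ... | no  _ = Coeff m f

  NoGoodPoint : {n : ℕ} → (Fin n → Fin n → F) → Set
  NoGoodPoint {n} A = ¬ (Σ (Fin n → F) λ x → (i : Fin n) → (¬ x i ≡ 0F) × (¬ linF A x i ≡ 0F))

-- Write P_k = Σ_{a ∈ 𝔽_p} a^k. Expanding Σ_a (a + 1)^k = P_k binomially gives P_k = 0 for k < p - 1, and Fermat
-- gives P_{p-1} = -1; so Σ_x x^e = ∏_i P_{e_i} vanishes as soon as some e_i < p - 1.
--
-- If there is no good point, the summand of ⟨∏ (Ax)_i^{r_i}, ∏ x_i^{s_i}⟩ vanishes at every x. Conversely, if x₀ is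
-- good, the indicator ∏_i (1 - (x_i - x₀_i)^{p-1}) of x₀ is, as x₀_i ≠ 0, a combination of monomials with all
-- exponents in [1, p - 1]; so by hypothesis Σ_x ∏ (Ax)_i^{p-1} · indicator vanishes, although it equals the nonzero
-- value ∏ (Ax₀)_i^{p-1}.
--
-- For the coefficients, ∏ (Ax)_i^{r_i} is homogeneous of degree Σ s'_i, and pairing it with the monomial with
-- exponents p - 1 - s'_i gives (-1)^n times the coefficient of x^{s'} by the power sums; by the first part the
-- pairing vanishes. Reduction only lowers exponents, so on a homogeneous polynomial it does not change the
-- coefficient of x^{s'}, whose exponents are already reduced.

module Submission where

open import Defs
open import Data.Nat using (ℕ; NonZero; _≤_; _<_; _∸_)
open import Data.Nat.Primality using (Prime)
open import Data.Fin using (Fin)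
open import Data.Vec using (tabulate)
open import Data.Product using (_×_)
open import Function.Bundles using (_⇔_; mk⇔)
open import Relation.Binary.PropositionalEquality using (_≡_)

open import Level using (0ℓ)
open import Data.Nat as ℕ using (zero; suc; _%_; _!; z≤n; s≤s)
open import Data.Nat.Combinatorics using (_C_; nCn≡1; nC1≡n; nCk≡nC[n∸k]; nCk≡n!/k![n-k]!; k![n∸k]!∣n!)
import Data.Nat.Properties as ℕ
open import Data.Nat.DivMod using (_mod_; m/n*n≡m; %-distribˡ-+; %-distribˡ-*; m%n%n≡m%n; m<n⇒m%n≡m; n%n≡0)
open import Data.Fin as Fin using (toℕ)
open import Data.Fin.Properties as Fin using (toℕ-fromℕ<; toℕ-injective; toℕ<n; _≟_)
open import Data.Product using (_,_; ∃; proj₁; proj₂)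
open import Relation.Binary.PropositionalEquality as ≡ using (_≢_; _≗_)
import Data.List.Properties as List
open import Algebra.Bundles using (CommutativeRing; CommutativeSemiring)
import Algebra.Properties.CommutativeMonoid.Sum as MonoidSum
import Algebra.Properties.Semiring.Sum as SemiringSum
open import Data.Vec.Functional as Vector using (Vector)
open import Data.List as List using (List; []; _∷_)
open import Function using (_∘_)
open import Algebra.Structures using (IsCommutativeRing)

foldr-map-allFin : ∀ {a} {A : Set a} (_∙_ : A → A → A) (e : A) {n} (f : Fin n → A) →
  List.foldr _∙_ e (List.map f (List.allFin n)) ≡ Vector.foldr _∙_ e f
foldr-map-allFin _∙_ e {n} f = ≡.trans (≡.cong (List.foldr _∙_ e) (List.map-tabulate (λ i → i) f)) (go f)
  where
  go : ∀ {k} (g : Fin k → _) → List.foldr _∙_ e (List.tabulate g) ≡ Vector.foldr _∙_ e g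
  go {zero}  g = ≡.refl
  go {suc k} g = ≡.cong (g Fin.zero ∙_) (go (g ∘ Fin.suc))

module MapSums {c ℓ} (R : CommutativeSemiring c ℓ) where
  open CommutativeSemiring R
  open SemiringSum semiring public
  open import Relation.Binary.Reasoning.Setoid setoid
  module Prod = MonoidSum *-commutativeMonoid
  open Prod public using () renaming (sum to prod)

  sum-zero : ∀ {n} (f : Vector Carrier n) → (∀ i → f i ≈ 0#) → sum f ≈ 0#
  sum-zero {n} f z = trans (sum-cong-≋ {y = Vector.replicate n 0#} z) (sum-replicate-zero n)

  sum-single : ∀ {n} (f : Vector Carrier n) i → (∀ j → j ≢ i → f j ≈ 0#) → sum f ≈ f i
  sum-single f Fin.zero z =
    trans (+-congˡ (sum-zero _ (λ j → z (Fin.suc j) λ ()))) (+-identityʳ _)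
  sum-single f (Fin.suc i) z = trans (+-congʳ (z Fin.zero λ ()))
    (trans (+-identityˡ _) (sum-single (f ∘ Fin.suc) i (λ j j≢i → z (Fin.suc j) (j≢i ∘ Fin.suc-injective))))

  prod-one : ∀ {n} (f : Vector Carrier n) → (∀ i → f i ≈ 1#) → prod f ≈ 1#
  prod-one {n} f o = trans (Prod.sum-cong-≋ {y = Vector.replicate n 1#} o) (Prod.sum-replicate-zero n)

  prod-single : ∀ {n} (f : Vector Carrier n) i → (∀ j → j ≢ i → f j ≈ 1#) → prod f ≈ f i
  prod-single f Fin.zero o =
    trans (*-congˡ (prod-one _ (λ j → o (Fin.suc j) λ ()))) (*-identityʳ _)
  prod-single f (Fin.suc i) o = trans (*-congʳ (o Fin.zero λ ()))
    (trans (*-identityˡ _) (prod-single (f ∘ Fin.suc) i (λ j j≢i → o (Fin.suc j) (j≢i ∘ Fin.suc-injective))))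

  prod-zero : ∀ {n} (f : Vector Carrier n) i → f i ≈ 0# → prod f ≈ 0#
  prod-zero f Fin.zero fi≈0 = trans (*-congʳ fi≈0) (zeroˡ _)
  prod-zero f (Fin.suc i) fi≈0 = trans (*-congˡ (prod-zero (f ∘ Fin.suc) i fi≈0)) (zeroʳ _)

  sumList : List Carrier → Carrier
  sumList = List.foldr _+_ 0#

  sumList-++ : ∀ xs ys → sumList (xs List.++ ys) ≈ sumList xs + sumList ys
  sumList-++ []       ys = sym (+-identityˡ _)
  sumList-++ (x ∷ xs) ys = trans (+-congˡ (sumList-++ xs ys)) (sym (+-assoc _ _ _))

  sumList-concatMap : ∀ {A B : Set} (g : B → Carrier) (f : A → List B) (l : List A) →
    sumList (List.map g (List.concatMap f l)) ≈ sumList (List.map (λ a → sumList (List.map g (f a))) l)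
  sumList-concatMap g f []      = refl
  sumList-concatMap g f (a ∷ l) = begin
    sumList (List.map g (f a List.++ List.concatMap f l))
      ≡⟨ ≡.cong sumList (List.map-++ g (f a) (List.concatMap f l)) ⟩
    sumList (List.map g (f a) List.++ List.map g (List.concatMap f l))
      ≈⟨ sumList-++ (List.map g (f a)) _ ⟩
    sumList (List.map g (f a)) + sumList (List.map g (List.concatMap f l))
      ≈⟨ +-congˡ (sumList-concatMap g f l) ⟩
    sumList (List.map g (f a)) + sumList (List.map (λ a → sumList (List.map g (f a))) l)
      ∎

  sum-init-last-toℕ : ∀ n (t : ℕ → Carrier) → ∑[ k ≤ n ] t (toℕ k) ≈ ∑[ k < n ] t (toℕ k) + t n
  sum-init-last-toℕ n t = trans (sum-init-last (t ∘ toℕ)) (+-cong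
    (reflexive (sum-cong-≗ {n} (λ k → ≡.cong t (Fin.toℕ-inject₁ k))))
    (reflexive (≡.cong t (Fin.toℕ-fromℕ n))))

  *-distribˡ-sumList : ∀ a xs → a * sumList xs ≈ sumList (List.map (a *_) xs)
  *-distribˡ-sumList a []       = zeroʳ a
  *-distribˡ-sumList a (x ∷ xs) = trans (distribˡ a x (sumList xs)) (+-congˡ (*-distribˡ-sumList a xs))

  sumMaps : (n m : ℕ) → ((Fin n → Fin m) → Carrier) → Carrier
  sumMaps zero    m g = g (λ ())
  sumMaps (suc n) m g = ∑[ a < m ] sumMaps n m (λ v → g (a Vector.∷ v))

  module _ {m : ℕ} where

    sumMaps-cong : ∀ n {g h : (Fin n → Fin m) → Carrier} → (∀ x → g x ≈ h x) → sumMaps n m g ≈ sumMaps n m h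
    sumMaps-cong zero    g≈h = g≈h _
    sumMaps-cong (suc n) g≈h = sum-cong-≋ (λ a → sumMaps-cong n (λ v → g≈h (a Vector.∷ v)))

    sumMaps-zero : ∀ n (g : (Fin n → Fin m) → Carrier) → (∀ x → g x ≈ 0#) → sumMaps n m g ≈ 0#
    sumMaps-zero zero    g z = z _
    sumMaps-zero (suc n) g z = sum-zero _ (λ a → sumMaps-zero n (g ∘ (a Vector.∷_)) (λ v → z (a Vector.∷ v)))

    sumMaps-distrib-+ : ∀ n (g h : (Fin n → Fin m) → Carrier) →
      sumMaps n m (λ x → g x + h x) ≈ sumMaps n m g + sumMaps n m h
    sumMaps-distrib-+ zero    g h = refl
    sumMaps-distrib-+ (suc n) g h = trans (sum-cong-≋ (λ a → sumMaps-distrib-+ n (g ∘ (a Vector.∷_)) (h ∘ (a Vector.∷_))))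
      (∑-distrib-+ (λ a → sumMaps n m (g ∘ (a Vector.∷_))) (λ a → sumMaps n m (h ∘ (a Vector.∷_))))

    *-distribˡ-sumMaps : ∀ n x (g : (Fin n → Fin m) → Carrier) → x * sumMaps n m g ≈ sumMaps n m (λ σ → x * g σ)
    *-distribˡ-sumMaps zero    x g = refl
    *-distribˡ-sumMaps (suc n) x g =
      trans (*-distribˡ-sum x (λ a → sumMaps n m (g ∘ (a Vector.∷_)))) (sum-cong-≋ (λ a → *-distribˡ-sumMaps n x (g ∘ (a Vector.∷_))))

    sumMaps-∑-comm : ∀ n {k} (g : Fin k → (Fin n → Fin m) → Carrier) →
      sumMaps n m (λ x → ∑[ u < k ] g u x) ≈ ∑[ u < k ] sumMaps n m (g u)
    sumMaps-∑-comm zero    g = refl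
    sumMaps-∑-comm (suc n) g = trans (sum-cong-≋ (λ a → sumMaps-∑-comm n (λ u → g u ∘ (a Vector.∷_))))
      (∑-comm (λ a u → sumMaps n m (g u ∘ (a Vector.∷_))))

    sumMaps-comm : ∀ n {n′ m′} (g : (Fin n′ → Fin m′) → (Fin n → Fin m) → Carrier) →
      sumMaps n m (λ x → sumMaps n′ m′ (λ y → g y x)) ≈ sumMaps n′ m′ (λ y → sumMaps n m (g y))
    sumMaps-comm n {zero}   g = refl
    sumMaps-comm n {suc n′} g = trans (sumMaps-∑-comm n (λ a x → sumMaps n′ _ (λ y → g (a Vector.∷ y) x)))
      (sum-cong-≋ (λ a → sumMaps-comm n (g ∘ (a Vector.∷_))))

    sumMaps-foldr : ∀ n {A : Set} (g : A → (Fin n → Fin m) → Carrier) (l : List A) →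
      sumMaps n m (λ x → sumList (List.map (λ t → g t x) l)) ≈ sumList (List.map (λ t → sumMaps n m (g t)) l)
    sumMaps-foldr n g []      = sumMaps-zero n _ (λ _ → refl)
    sumMaps-foldr n g (t ∷ l) = trans (sumMaps-distrib-+ n _ _) (+-congˡ (sumMaps-foldr n g l))

    prod-sum-distrib : ∀ n (h : Fin n → Fin m → Carrier) →
      prod (λ i → sum (h i)) ≈ sumMaps n m (λ σ → prod (λ i → h i (σ i)))
    prod-sum-distrib zero    h = refl
    prod-sum-distrib (suc n) h = begin
      sum (h Fin.zero) * prod (λ i → sum (h (Fin.suc i)))
        ≈⟨ *-congˡ (prod-sum-distrib n (h ∘ Fin.suc)) ⟩
      sum (h Fin.zero) * sumMaps n m (λ σ → prod (λ i → h (Fin.suc i) (σ i)))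
        ≈⟨ *-distribʳ-sum _ (h Fin.zero) ⟩
      ∑[ a < m ] (h Fin.zero a * sumMaps n m (λ σ → prod (λ i → h (Fin.suc i) (σ i))))
        ≈⟨ sum-cong-≋ (λ a → *-distribˡ-sumMaps n (h Fin.zero a) _) ⟩
      ∑[ a < m ] sumMaps n m (λ σ → h Fin.zero a * prod (λ i → h (Fin.suc i) (σ i)))
        ∎

    sumMaps-single : ∀ n (g : (Fin n → Fin m) → Carrier) (x₀ : Fin n → Fin m) →
      (∀ {x y} → x ≗ y → g x ≈ g y) → (∀ x i → x i ≢ x₀ i → g x ≈ 0#) → sumMaps n m g ≈ g x₀
    sumMaps-single zero    g x₀ g-cong z = g-cong (λ ())
    sumMaps-single (suc n) g x₀ g-cong z =
      trans (sum-single _ (x₀ Fin.zero) (λ a a≢ → sumMaps-zero n _ (λ v → z (a Vector.∷ v) Fin.zero a≢)))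
        (trans (sumMaps-single n _ (x₀ ∘ Fin.suc) (λ x≗y → g-cong λ { Fin.zero → ≡.refl ; (Fin.suc i) → x≗y i })
                 (λ x i → z (x₀ Fin.zero Vector.∷ x) (Fin.suc i)))
               (g-cong λ { Fin.zero → ≡.refl ; (Fin.suc i) → ≡.refl }))

open import Relation.Binary.PropositionalEquality using (refl; sym; trans; cong; cong₂; subst; isEquivalence; module ≡-Reasoning)
open import Relation.Nullary using (¬_; contradiction)
open import Data.Sum as Sum using (_⊎_; inj₁; inj₂)
open import Relation.Nullary.Decidable using (_⊎-dec_)
open import Function using (id; flip)
open import Data.Nat.Divisibility using (_∣_; ∣⇒≤; n∣m⇒m%n≡0; m%n≡0⇒n∣m; ∣1⇒≡1; ∣m⇒∣m*n; ∣-refl)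
open import Data.Nat.Primality using (prime⇒nonTrivial; euclidsLemma)
import Algebra.Properties.Ring as RingProperties
import Algebra.Properties.Group as GroupProperties
import Algebra.Properties.Monoid as MonoidProperties
import Algebra.Properties.Loop as LoopProperties
import Algebra.Properties.AbelianGroup as AbelianGroupProperties
import Algebra.Properties.CommutativeSemigroup as CommutativeSemigroupProperties
open import Data.Fin.Permutation using (permutation)
open import Data.Nat.Induction using (<-rec)
open import Data.Bool using (if_then_else_; true; false; T)
open import Data.List.Relation.Unary.All as All using (All; []; _∷_)
import Data.List.Relation.Unary.All.Properties as All
open import Relation.Nullary using (yes; no)
open import Relation.Nullary.Decidable using (⌊_⌋)
open import Data.Vec as Vec using (Vec)
import Data.Vec.Properties as Vec

module ℕ-Sum = MapSums ℕ.+-*-commutativeSemiring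

ℕ-sum-mono-≤ : ∀ {n} (f g : Fin n → ℕ) → (∀ i → g i ≤ f i) → ℕ-Sum.sum g ≤ ℕ-Sum.sum f
ℕ-sum-mono-≤ {zero}  f g g≤f = z≤n
ℕ-sum-mono-≤ {suc n} f g g≤f = ℕ.+-mono-≤ (g≤f Fin.zero) (ℕ-sum-mono-≤ (f ∘ Fin.suc) (g ∘ Fin.suc) (g≤f ∘ Fin.suc))

ℕ-sum-≡∧≥⇒≗ : ∀ {n} (f g : Fin n → ℕ) → (∀ i → g i ≤ f i) → ℕ-Sum.sum f ≡ ℕ-Sum.sum g → f ≗ g
ℕ-sum-≡∧≥⇒≗ {zero}  f g g≤f Σf≡Σg ()
ℕ-sum-≡∧≥⇒≗ {suc n} f g g≤f Σf≡Σg = λ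
  { Fin.zero    → f₀≡g₀
  ; (Fin.suc i) → ℕ-sum-≡∧≥⇒≗ (f ∘ Fin.suc) (g ∘ Fin.suc) (g≤f ∘ Fin.suc) Σf′≡Σg′ i }
  where
  Σg′≤Σf′ : ℕ-Sum.sum (g ∘ Fin.suc) ≤ ℕ-Sum.sum (f ∘ Fin.suc)
  Σg′≤Σf′ = ℕ-sum-mono-≤ (f ∘ Fin.suc) (g ∘ Fin.suc) (g≤f ∘ Fin.suc)
  f₀≡g₀ : f Fin.zero ≡ g Fin.zero
  f₀≡g₀ = ℕ.≤-antisym
    (ℕ.+-cancelʳ-≤ _ (f Fin.zero) (g Fin.zero) (ℕ.≤-trans (ℕ.≤-reflexive Σf≡Σg) (ℕ.+-monoʳ-≤ (g Fin.zero) Σg′≤Σf′)))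
    (g≤f Fin.zero)
  Σf′≡Σg′ : ℕ-Sum.sum (f ∘ Fin.suc) ≡ ℕ-Sum.sum (g ∘ Fin.suc)
  Σf′≡Σg′ = ℕ.+-cancelˡ-≡ (f Fin.zero) _ _ (trans Σf≡Σg (cong (ℕ._+ ℕ-Sum.sum (g ∘ Fin.suc)) (sym f₀≡g₀)))

module Modular (p : ℕ) .{{_ : NonZero p}} where
  open FF p

  toℕ-mod : ∀ m → toℕ (m mod p) ≡ m % p
  toℕ-mod m = toℕ-fromℕ< _

  mod-cong : ∀ {m n} → m % p ≡ n % p → m mod p ≡ n mod p
  mod-cong {m} {n} eq = toℕ-injective (trans (toℕ-mod m) (trans eq (sym (toℕ-mod n))))

  mod-toℕ : ∀ a → toℕ a mod p ≡ a
  mod-toℕ a = toℕ-injective (trans (toℕ-mod (toℕ a)) (m<n⇒m%n≡m (toℕ<n a)))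

  toℕ-0F : toℕ 0F ≡ 0
  toℕ-0F = trans (toℕ-mod 0) (m<n⇒m%n≡m (ℕ.>-nonZero⁻¹ p))

  mod-absorbˡ-+ : ∀ m n → (toℕ (m mod p) ℕ.+ n) mod p ≡ (m ℕ.+ n) mod p
  mod-absorbˡ-+ m n = mod-cong (begin
    (toℕ (m mod p) ℕ.+ n) % p       ≡⟨ cong (λ k → (k ℕ.+ n) % p) (toℕ-mod m) ⟩
    (m % p ℕ.+ n) % p               ≡⟨ %-distribˡ-+ (m % p) n p ⟩
    (m % p % p ℕ.+ n % p) % p       ≡⟨ cong (λ k → (k ℕ.+ n % p) % p) (m%n%n≡m%n m p) ⟩
    (m % p ℕ.+ n % p) % p           ≡⟨ %-distribˡ-+ m n p ⟨
    (m ℕ.+ n) % p                   ∎)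
    where open ≡-Reasoning

  mod-absorbʳ-+ : ∀ m n → (m ℕ.+ toℕ (n mod p)) mod p ≡ (m ℕ.+ n) mod p
  mod-absorbʳ-+ m n = trans (cong (_mod p) (ℕ.+-comm m _))
    (trans (mod-absorbˡ-+ n m) (cong (_mod p) (ℕ.+-comm n m)))

  mod-absorbˡ-* : ∀ m n → (toℕ (m mod p) ℕ.* n) mod p ≡ (m ℕ.* n) mod p
  mod-absorbˡ-* m n = mod-cong (begin
    (toℕ (m mod p) ℕ.* n) % p       ≡⟨ cong (λ k → (k ℕ.* n) % p) (toℕ-mod m) ⟩
    (m % p ℕ.* n) % p               ≡⟨ %-distribˡ-* (m % p) n p ⟩
    (m % p % p ℕ.* (n % p)) % p     ≡⟨ cong (λ k → (k ℕ.* (n % p)) % p) (m%n%n≡m%n m p) ⟩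
    (m % p ℕ.* (n % p)) % p         ≡⟨ %-distribˡ-* m n p ⟨
    (m ℕ.* n) % p                   ∎)
    where open ≡-Reasoning

  mod-absorbʳ-* : ∀ m n → (m ℕ.* toℕ (n mod p)) mod p ≡ (m ℕ.* n) mod p
  mod-absorbʳ-* m n = trans (cong (_mod p) (ℕ.*-comm m _))
    (trans (mod-absorbˡ-* n m) (cong (_mod p) (ℕ.*-comm n m)))

  mod-+ : ∀ m n → (m ℕ.+ n) mod p ≡ (m mod p) +F (n mod p)
  mod-+ m n = sym (trans (mod-absorbˡ-+ m _) (mod-absorbʳ-+ m n))

  +F-assoc : ∀ a b c → (a +F b) +F c ≡ a +F (b +F c)
  +F-assoc a b c = trans (mod-absorbˡ-+ _ _)
    (trans (cong (_mod p) (ℕ.+-assoc (toℕ a) _ _)) (sym (mod-absorbʳ-+ _ _)))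

  *F-assoc : ∀ a b c → (a *F b) *F c ≡ a *F (b *F c)
  *F-assoc a b c = trans (mod-absorbˡ-* _ _)
    (trans (cong (_mod p) (ℕ.*-assoc (toℕ a) _ _)) (sym (mod-absorbʳ-* (toℕ a) _)))

  +F-comm : ∀ a b → a +F b ≡ b +F a
  +F-comm a b = cong (_mod p) (ℕ.+-comm (toℕ a) _)

  *F-comm : ∀ a b → a *F b ≡ b *F a
  *F-comm a b = cong (_mod p) (ℕ.*-comm (toℕ a) _)

  +F-identityˡ : ∀ a → 0F +F a ≡ a
  +F-identityˡ a = trans (cong (λ k → (k ℕ.+ toℕ a) mod p) toℕ-0F) (mod-toℕ a)

  *F-identityˡ : ∀ a → 1F *F a ≡ a
  *F-identityˡ a = trans (mod-absorbˡ-* 1 (toℕ a)) (trans (cong (_mod p) (ℕ.*-identityˡ _)) (mod-toℕ a))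

  -F-inverseˡ : ∀ a → (-F a) +F a ≡ 0F
  -F-inverseˡ a = trans (mod-absorbˡ-+ _ _)
    (mod-cong (trans (cong (_% p) (ℕ.m∸n+n≡m (ℕ.<⇒≤ (toℕ<n a))))
      (trans (n%n≡0 p) (sym (m<n⇒m%n≡m (ℕ.>-nonZero⁻¹ p))))))

  *F-distribˡ-+F : ∀ a b c → a *F (b +F c) ≡ (a *F b) +F (a *F c)
  *F-distribˡ-+F a b c = begin
    a *F (b +F c)                        ≡⟨ mod-absorbʳ-* x (y ℕ.+ z) ⟩
    (x ℕ.* (y ℕ.+ z)) mod p              ≡⟨ cong (_mod p) (ℕ.*-distribˡ-+ x y z) ⟩
    (x ℕ.* y ℕ.+ x ℕ.* z) mod p          ≡⟨ mod-+ (x ℕ.* y) (x ℕ.* z) ⟩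
    (a *F b) +F (a *F c)                 ∎
    where
    open ≡-Reasoning
    x = toℕ a
    y = toℕ b
    z = toℕ c

  isCommutativeRing : IsCommutativeRing _≡_ _+F_ _*F_ -F_ 0F 1F
  isCommutativeRing = record
    { isRing = record
      { +-isAbelianGroup = record
        { isGroup = record
          { isMonoid = record
            { isSemigroup = record
              { isMagma = record { isEquivalence = isEquivalence ; ∙-cong = cong₂ _+F_ }
              ; assoc = +F-assoc }
            ; identity = +F-identityˡ , λ a → trans (+F-comm a 0F) (+F-identityˡ a) }
          ; inverse = -F-inverseˡ , λ a → trans (+F-comm a _) (-F-inverseˡ a)
          ; ⁻¹-cong = cong -F_ }
        ; comm = +F-comm }
      ; *-cong = cong₂ _*F_
      ; *-assoc = *F-assoc
      ; *-identity = *F-identityˡ , λ a → trans (*F-comm a 1F) (*F-identityˡ a)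
      ; distrib = *F-distribˡ-+F , λ a b c → trans (*F-comm (b +F c) a)
          (trans (*F-distribˡ-+F a b c) (cong₂ _+F_ (*F-comm a b) (*F-comm a c))) }
    ; *-comm = *F-comm }

  commutativeRing : CommutativeRing 0ℓ 0ℓ
  commutativeRing = record { isCommutativeRing = isCommutativeRing }

module ModularSums (p : ℕ) .{{_ : NonZero p}} where
  open FF p
  open Modular p public
  open CommutativeRing commutativeRing public hiding (isCommutativeRing; refl; sym; trans)
  open MapSums commutativeSemiring public
  open import Algebra.Properties.Semiring.Mult semiring public using (×-assoc-*) renaming (_×_ to _·_)
  open import Algebra.Properties.Semiring.Exp semiring public using (_^_; ^-homo-*)
  import Algebra.Properties.CommutativeSemiring.Binomial commutativeSemiring as Binomial

  ΣF≡sum : ∀ n f → ΣF n f ≡ sum f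
  ΣF≡sum n f = foldr-map-allFin _+_ 0# f

  ΠF≡prod : ∀ n f → ΠF n f ≡ prod f
  ΠF≡prod n f = foldr-map-allFin _*_ 1# f

  sumList-allPts : ∀ n (g : (Fin n → F) → F) → sumList (List.map g (allPts n)) ≡ sumMaps n p g
  sumList-allPts zero    g = +-identityʳ _
  sumList-allPts (suc n) g = begin
    sumList (List.map g (allPts (suc n)))
      ≡⟨ sumList-concatMap g _ (List.allFin p) ⟩
    sumList (List.map (λ a → sumList (List.map g (List.map (a Vector.∷_) (allPts n)))) (List.allFin p))
      ≡⟨ cong sumList (List.map-cong (λ a → trans (cong sumList (sym (List.map-∘ (allPts n))))
                                                   (sumList-allPts n (g ∘ (a Vector.∷_)))) (List.allFin p)) ⟩
    ΣF p (λ a → sumMaps n p (g ∘ (a Vector.∷_)))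
      ≡⟨ ΣF≡sum p _ ⟩
    sumMaps (suc n) p g ∎
    where open ≡-Reasoning

  inner≡sumMaps : ∀ {n} (u w : (Fin n → F) → F) → inner u w ≡ sumMaps n p (λ x → u x * w x)
  inner≡sumMaps {n} u w = sumList-allPts n (λ x → u x * w x)

  ·1#≡mod : ∀ n → n · 1# ≡ n mod p
  ·1#≡mod zero    = refl
  ·1#≡mod (suc n) = trans (cong (1# +_) (·1#≡mod n)) (sym (mod-+ 1 n))

  ·≡mod* : ∀ n x → n · x ≡ (n mod p) * x
  ·≡mod* n x = trans (cong (n ·_) (sym (*-identityˡ x))) (trans (sym (×-assoc-* n 1# x)) (cong (_* x) (·1#≡mod n)))

  ^F≡^ : ∀ x n → x ^F n ≡ x ^ n
  ^F≡^ x zero    = refl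
  ^F≡^ x (suc n) = cong (x *_) (^F≡^ x n)

  1#^≡1# : ∀ n → 1# ^ n ≡ 1#
  1#^≡1# zero    = refl
  1#^≡1# (suc n) = trans (*-identityˡ _) (1#^≡1# n)

  binomial : ∀ n x y → (x + y) ^ n ≡ ∑[ k ≤ n ] ((n C toℕ k) mod p * (x ^ toℕ k * y ^ (n ∸ toℕ k)))
  binomial n x y = begin
    (x + y) ^ n
      ≡⟨ Binomial.theorem n x y ⟩
    ∑[ k ≤ n ] ((n C toℕ k) · (x ^ toℕ k * y ^ (n ∸ toℕ k)))
      ≡⟨ sum-cong-≗ {suc n} (λ k → ·≡mod* (n C toℕ k) (x ^ toℕ k * y ^ (n ∸ toℕ k))) ⟩
    ∑[ k ≤ n ] ((n C toℕ k) mod p * (x ^ toℕ k * y ^ (n ∸ toℕ k))) ∎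
    where open ≡-Reasoning

  binomial-+1 : ∀ n x → (x + 1#) ^ n ≡ ∑[ k ≤ n ] ((n C toℕ k) mod p * x ^ toℕ k)
  binomial-+1 n x = begin
    (x + 1#) ^ n
      ≡⟨ binomial n x 1# ⟩
    ∑[ k ≤ n ] ((n C toℕ k) mod p * (x ^ toℕ k * 1# ^ (n ∸ toℕ k)))
      ≡⟨ sum-cong-≗ {suc n} (λ k → cong ((n C toℕ k) mod p *_)
           (trans (cong (x ^ toℕ k *_) (1#^≡1# (n ∸ toℕ k))) (*-identityʳ (x ^ toℕ k)))) ⟩
    ∑[ k ≤ n ] ((n C toℕ k) mod p * x ^ toℕ k) ∎
    where open ≡-Reasoning

n∣n! : ∀ n .{{_ : NonZero n}} → n ∣ n !
n∣n! (suc m) = ∣m⇒∣m*n (m !) (∣-refl {suc m})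

module PrimeField (p : ℕ) .{{_ : NonZero p}} (p-prime : Prime p) where
  open FF p
  open ModularSums p public
  private
    module RingProps = RingProperties ring
    module GroupProps = GroupProperties +-group
    module MonoidProps = MonoidProperties +-monoid
    module LoopProps = LoopProperties GroupProps.loop
    module AbelianGroupProps = AbelianGroupProperties +-abelianGroup
    module CommSemigroupProps = CommutativeSemigroupProperties *-commutativeSemigroup

  1<p : 1 < p
  1<p = ℕ.nonTrivial⇒n>1 p {{prime⇒nonTrivial p-prime}}

  0<p-1 : 0 < p ∸ 1
  0<p-1 = ℕ.m<n⇒0<n∸m 1<p

  p-1<p : p ∸ 1 < p
  p-1<p = ℕ.∸-monoʳ-< {p} {1} {0} ℕ.≤-refl (ℕ.<⇒≤ 1<p)

  p∣m⇒m<p⇒m≡0 : ∀ {m} → p ∣ m → m < p → m ≡ 0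
  p∣m⇒m<p⇒m≡0 {zero}  _   _   = refl
  p∣m⇒m<p⇒m≡0 {suc m} p∣m m<p = contradiction (∣⇒≤ p∣m) (ℕ.<⇒≱ m<p)

  toℕ-≡0# : ∀ {a} → a ≡ 0# → toℕ a ≡ 0
  toℕ-≡0# refl = toℕ-0F

  p∣toℕ⇒≡0# : ∀ {a} → p ∣ toℕ a → a ≡ 0#
  p∣toℕ⇒≡0# {a} p∣a = toℕ-injective (trans (p∣m⇒m<p⇒m≡0 p∣a (toℕ<n a)) (sym toℕ-0F))

  p∣⇒mod≡0# : ∀ {m} → p ∣ m → m mod p ≡ 0#
  p∣⇒mod≡0# {m} p∣m = mod-cong (trans (n∣m⇒m%n≡0 m p p∣m) (sym (m<n⇒m%n≡m (ℕ.>-nonZero⁻¹ p))))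

  mod≢0# : ∀ {m} → 0 < m → m < p → m mod p ≢ 0#
  mod≢0# {m} 0<m m<p m≡0 = ℕ.<⇒≢ 0<m (sym (begin
    m                ≡⟨ m<n⇒m%n≡m m<p ⟨
    m % p            ≡⟨ toℕ-mod m ⟨
    toℕ (m mod p)    ≡⟨ toℕ-≡0# m≡0 ⟩
    0                ∎))
    where open ≡-Reasoning

  1#≢0# : 1# ≢ 0#
  1#≢0# = mod≢0# (s≤s z≤n) 1<p

  x*y≡0⇒x≡0∨y≡0 : ∀ a b → a * b ≡ 0# → a ≡ 0# ⊎ b ≡ 0#
  x*y≡0⇒x≡0∨y≡0 a b ab≡0 =
    Sum.map p∣toℕ⇒≡0# p∣toℕ⇒≡0# (euclidsLemma (toℕ a) (toℕ b) p-prime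
      (m%n≡0⇒n∣m _ p (trans (sym (toℕ-mod _)) (toℕ-≡0# ab≡0))))

  *-nonzero : ∀ {a b} → a ≢ 0# → b ≢ 0# → a * b ≢ 0#
  *-nonzero {a} {b} a≢0 b≢0 ab≡0 = Sum.[ a≢0 , b≢0 ] (x*y≡0⇒x≡0∨y≡0 a b ab≡0)

  x≢0∧x*y≡0⇒y≡0 : ∀ {a} b → a ≢ 0# → a * b ≡ 0# → b ≡ 0#
  x≢0∧x*y≡0⇒y≡0 {a} b a≢0 ab≡0 = Sum.[ flip contradiction a≢0 , id ] (x*y≡0⇒x≡0∨y≡0 a b ab≡0)

  *-cancelˡ : ∀ {a} b c → a ≢ 0# → a * b ≡ a * c → b ≡ c
  *-cancelˡ {a} b c a≢0 ab≡ac = GroupProps.x∙y⁻¹≈ε⇒x≈y b c (x≢0∧x*y≡0⇒y≡0 (b - c) a≢0 (begin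
    a * (b - c)     ≡⟨ RingProps.x[y-z]≈xy-xz a b c ⟩
    a * b - a * c   ≡⟨ cong (_- a * c) ab≡ac ⟩
    a * c - a * c   ≡⟨ -‿inverseʳ (a * c) ⟩
    0#              ∎))
    where open ≡-Reasoning

  -‿nonzero : ∀ {a} → a ≢ 0# → - a ≢ 0#
  -‿nonzero {a} a≢0 -a≡0 = a≢0 (trans (sym (GroupProps.⁻¹-involutive a)) (trans (cong -_ -a≡0) GroupProps.ε⁻¹≈ε))

  ^-nonzero : ∀ {a} n → a ≢ 0# → a ^ n ≢ 0#
  ^-nonzero zero    a≢0 = 1#≢0#
  ^-nonzero (suc n) a≢0 = *-nonzero a≢0 (^-nonzero n a≢0)

  0#^≡0# : ∀ {n} → 0 < n → 0# ^ n ≡ 0#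
  0#^≡0# {suc n} _ = zeroˡ _

  -‿sum : ∀ {n} (f : Vector F n) → - sum f ≡ ∑[ i < n ] (- f i)
  -‿sum f = begin
    - sum f               ≡⟨ RingProps.-1*x≈-x (sum f) ⟨
    - 1# * sum f          ≡⟨ *-distribˡ-sum (- 1#) f ⟩
    ∑[ i < _ ] (- 1# * f i) ≡⟨ sum-cong-≗ (λ i → RingProps.-1*x≈-x (f i)) ⟩
    ∑[ i < _ ] (- f i)    ∎
    where open ≡-Reasoning

  prod-nonzero : ∀ {n} (f : Vector F n) → (∀ i → f i ≢ 0#) → prod f ≢ 0#
  prod-nonzero {zero}  f f≢0 = 1#≢0#
  prod-nonzero {suc n} f f≢0 = *-nonzero (f≢0 Fin.zero) (prod-nonzero (f ∘ Fin.suc) (f≢0 ∘ Fin.suc))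

  p∤m! : ∀ {m} → m < p → ¬ p ∣ m !
  p∤m! {zero}  _   p∣1 = ℕ.<⇒≢ 1<p (sym (∣1⇒≡1 p∣1))
  p∤m! {suc m} m<p p∣m! with euclidsLemma (suc m) (m !) p-prime p∣m!
  ... | inj₁ p∣1+m = ℕ.1+n≢0 (p∣m⇒m<p⇒m≡0 p∣1+m m<p)
  ... | inj₂ p∣m!  = p∤m! (ℕ.<-trans (ℕ.n<1+n m) m<p) p∣m!

  -- p divides p! = (p C k) k! (p - k)! but neither factorial.
  p∣pCk : ∀ {k} → 0 < k → k < p → p ∣ p C k
  p∣pCk {k} 0<k k<p with euclidsLemma (p C k) (k ! ℕ.* (p ∸ k) !) p-prime p∣pCk*k!*[p-k]!
    where
    instance _ = ℕ._!*_!≢0 k (p ∸ k)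
    p∣pCk*k!*[p-k]! : p ∣ (p C k) ℕ.* (k ! ℕ.* (p ∸ k) !)
    p∣pCk*k!*[p-k]! = subst (p ∣_)
      (sym (trans (cong (ℕ._* (k ! ℕ.* (p ∸ k) !)) (nCk≡n!/k![n-k]! (ℕ.<⇒≤ k<p))) (m/n*n≡m (k![n∸k]!∣n! (ℕ.<⇒≤ k<p)))))
      (n∣n! p)
  ... | inj₁ p∣pCk = p∣pCk
  ... | inj₂ p∣k!*[p-k]! = contradiction (euclidsLemma (k !) ((p ∸ k) !) p-prime p∣k!*[p-k]!)
                               Sum.[ p∤m! k<p , p∤m! (ℕ.∸-monoʳ-< {p} {k} {0} 0<k (ℕ.<⇒≤ k<p)) ]

  freshman's-dream : ∀ x → (x + 1#) ^ p ≡ x ^ p + 1#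
  freshman's-dream x = begin
    (x + 1#) ^ p                              ≡⟨ binomial-+1 p x ⟩
    ∑[ k ≤ p ] term (toℕ k)                   ≡⟨ sum-init-last-toℕ p term ⟩
    ∑[ k < p ] term (toℕ k) + term p          ≡⟨ cong (_+ term p) (sum-single (term ∘ toℕ) 0# middle-terms) ⟩
    term (toℕ 0#) + term p                    ≡⟨ cong₂ _+_ (trans (cong term toℕ-0F) term0) termp ⟩
    1# + x ^ p                                ≡⟨ +-comm 1# (x ^ p) ⟩
    x ^ p + 1#                                ∎
    where
    open ≡-Reasoning
    term : ℕ → F
    term k = (p C k) mod p * x ^ k
    term0 : term 0 ≡ 1#
    term0 = trans (cong (λ c → c mod p * 1#) (trans (nCk≡nC[n∸k] {0} {p} z≤n) (nCn≡1 p))) (*-identityˡ _)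
    termp : term p ≡ x ^ p
    termp = trans (cong (λ c → c mod p * x ^ p) (nCn≡1 p)) (*-identityˡ _)
    middle-terms : ∀ k → k ≢ 0# → term (toℕ k) ≡ 0#
    middle-terms k k≢0 = trans (cong (_* x ^ toℕ k) (p∣⇒mod≡0# (p∣pCk 0<k (toℕ<n k)))) (zeroˡ _)
      where
      0<k : 0 < toℕ k
      0<k = ℕ.n≢0⇒n>0 (λ k≡0 → k≢0 (toℕ-injective (trans k≡0 (sym toℕ-0F))))

  fermat : ∀ x → x ^ p ≡ x
  fermat x = trans (cong (_^ p) (sym (mod-toℕ x))) (trans (fermat-mod (toℕ x)) (mod-toℕ x))
    where
    fermat-mod : ∀ m → (m mod p) ^ p ≡ m mod p
    fermat-mod zero    = trans (cong (0# ^_) (sym (ℕ.suc-pred p))) (zeroˡ _)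
    fermat-mod (suc m) = begin
      (suc m mod p) ^ p          ≡⟨ cong (_^ p) (trans (mod-+ 1 m) (+-comm 1# _)) ⟩
      (m mod p + 1#) ^ p         ≡⟨ freshman's-dream (m mod p) ⟩
      (m mod p) ^ p + 1#         ≡⟨ cong (_+ 1#) (fermat-mod m) ⟩
      m mod p + 1#               ≡⟨ trans (+-comm _ 1#) (sym (mod-+ 1 m)) ⟩
      suc m mod p                ∎
      where open ≡-Reasoning

  fermat-≢0# : ∀ {x} → x ≢ 0# → x ^ (p ∸ 1) ≡ 1#
  fermat-≢0# {x} x≢0 = *-cancelˡ _ _ x≢0
    (trans (trans (cong (x ^_) (ℕ.suc-pred p)) (fermat x)) (sym (*-identityʳ x)))

  powerSum : ℕ → F
  powerSum k = ∑[ a < p ] (a ^ k)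

  sum-shift : ∀ (g : F → F) → ∑[ a < p ] g (a + 1#) ≡ ∑[ a < p ] g a
  sum-shift g = sym (∑-permute g (permutation (_+ 1#) (_- 1#)
    (MonoidProps.cancelʳ (-‿inverseˡ 1#)) (MonoidProps.cancelʳ (-‿inverseʳ 1#))))

  -- Expand Σ_a (a + 1)^e, which equals Σ_a a^e, binomially.
  powerSum-binomial : ∀ e → ∑[ j ≤ e ] ((e C toℕ j) mod p * powerSum (toℕ j)) ≡ powerSum e
  powerSum-binomial e = begin
    ∑[ j ≤ e ] ((e C toℕ j) mod p * ∑[ a < p ] (a ^ toℕ j))
      ≡⟨ sum-cong-≗ {suc e} (λ j → *-distribˡ-sum ((e C toℕ j) mod p) (_^ toℕ j)) ⟩
    ∑[ j ≤ e ] ∑[ a < p ] ((e C toℕ j) mod p * a ^ toℕ j)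
      ≡⟨ ∑-comm {suc e} {p} (λ j a → (e C toℕ j) mod p * a ^ toℕ j) ⟩
    ∑[ a < p ] ∑[ j ≤ e ] ((e C toℕ j) mod p * a ^ toℕ j)
      ≡⟨ sum-cong-≗ {p} (λ a → sym (binomial-+1 e a)) ⟩
    ∑[ a < p ] ((a + 1#) ^ e)
      ≡⟨ sum-shift (_^ e) ⟩
    powerSum e ∎
    where open ≡-Reasoning

  lower-powerSums : ∀ e → ∑[ j < e ] ((e C toℕ j) mod p * powerSum (toℕ j)) ≡ 0#
  lower-powerSums e = LoopProps.identityˡ-unique _ (powerSum e) (begin
    ∑[ j < e ] term (toℕ j) + powerSum e  ≡⟨ cong (∑[ j < e ] term (toℕ j) +_) (sym top) ⟩
    ∑[ j < e ] term (toℕ j) + term e      ≡⟨ sum-init-last-toℕ e term ⟨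
    ∑[ j ≤ e ] term (toℕ j)               ≡⟨ powerSum-binomial e ⟩
    powerSum e                            ∎)
    where
    open ≡-Reasoning
    term : ℕ → F
    term j = (e C j) mod p * powerSum j
    top : term e ≡ powerSum e
    top = trans (cong (λ c → c mod p * powerSum e) (nCn≡1 e)) (*-identityˡ _)

  -- Strong induction: the last coefficient of lower-powerSums (k + 1) is k + 1, a unit as k + 1 < p.
  powerSum-vanishes : ∀ k → suc k < p → powerSum k ≡ 0#
  powerSum-vanishes = <-rec (λ k → suc k < p → powerSum k ≡ 0#) step
    where
    step : ∀ k → (∀ {j} → j < k → suc j < p → powerSum j ≡ 0#) → suc k < p → powerSum k ≡ 0#
    step k rec 1+k<p = x≢0∧x*y≡0⇒y≡0 (powerSum k) 1+kCk≢0 (begin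
      (suc k C k) mod p * powerSum k                             ≡⟨ +-identityˡ _ ⟨
      0# + term k                                                ≡⟨ cong (_+ term k) lower ⟨
      ∑[ j < k ] term (toℕ j) + term k                           ≡⟨ sum-init-last-toℕ k term ⟨
      ∑[ j < suc k ] term (toℕ j)                                ≡⟨ lower-powerSums (suc k) ⟩
      0#                                                         ∎)
      where
      open ≡-Reasoning
      term : ℕ → F
      term j = (suc k C j) mod p * powerSum j
      lower : ∑[ j < k ] term (toℕ j) ≡ 0#
      lower = sum-zero (term ∘ toℕ) (λ j → trans (cong ((suc k C toℕ j) mod p *_)
        (rec (toℕ<n j) (ℕ.<-trans (s≤s (toℕ<n j)) 1+k<p))) (zeroʳ ((suc k C toℕ j) mod p)))
      1+kCk≡1+k : suc k C k ≡ suc k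
      1+kCk≡1+k = trans (nCk≡nC[n∸k] (ℕ.n≤1+n k)) (trans (cong (suc k C_) (ℕ.m+n∸n≡m 1 k)) (nC1≡n (suc k)))
      1+kCk≢0 : (suc k C k) mod p ≢ 0#
      1+kCk≢0 = subst (λ m → m mod p ≢ 0#) (sym 1+kCk≡1+k) (mod≢0# (s≤s z≤n) 1+k<p)

  powerSum-top : powerSum (p ∸ 1) ≡ - 1#
  powerSum-top = begin
    ∑[ a < p ] (a ^ (p ∸ 1))                        ≡⟨ sum-cong-≗ {p} (λ a → sym (MonoidProps.cancelʳ (-‿inverseˡ 1#) _)) ⟩
    ∑[ a < p ] ((a ^ (p ∸ 1) - 1#) + 1#)            ≡⟨ ∑-distrib-+ (λ a → a ^ (p ∸ 1) - 1#) (λ _ → 1#) ⟩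
    ∑[ a < p ] (a ^ (p ∸ 1) - 1#) + ∑[ a < p ] 1#   ≡⟨ cong₂ _+_ (sum-single _ 0# units) ones ⟩
    (0# ^ (p ∸ 1) - 1#) + 0#                        ≡⟨ +-identityʳ _ ⟩
    0# ^ (p ∸ 1) - 1#                               ≡⟨ cong (_- 1#) (0#^≡0# 0<p-1) ⟩
    0# - 1#                                         ≡⟨ +-identityˡ _ ⟩
    - 1#                                            ∎
    where
    open ≡-Reasoning
    units : ∀ a → a ≢ 0# → a ^ (p ∸ 1) - 1# ≡ 0#
    units a a≢0 = trans (cong (_- 1#) (fermat-≢0# a≢0)) (-‿inverseʳ 1#)
    ones : ∑[ a < p ] 1# ≡ 0#
    ones = trans (sum-replicate p) (trans (·1#≡mod p) (p∣⇒mod≡0# (∣-refl {p})))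

  -- By Fermat, the indicator function of a.
  indicator : F → F → F
  indicator a y = 1# - (y - a) ^ (p ∸ 1)

  indicator-diag : ∀ a → indicator a a ≡ 1#
  indicator-diag a = begin
    1# - (a - a) ^ (p ∸ 1)   ≡⟨ cong (λ z → 1# - z ^ (p ∸ 1)) (-‿inverseʳ a) ⟩
    1# - 0# ^ (p ∸ 1)        ≡⟨ cong (λ z → 1# - z) (0#^≡0# 0<p-1) ⟩
    1# - 0#                  ≡⟨ cong (1# +_) GroupProps.ε⁻¹≈ε ⟩
    1# + 0#                  ≡⟨ +-identityʳ 1# ⟩
    1#                       ∎
    where open ≡-Reasoning

  indicator-off : ∀ {a y} → y ≢ a → indicator a y ≡ 0#
  indicator-off {a} {y} y≢a = trans (cong (λ z → 1# - z) (fermat-≢0# y-a≢0)) (-‿inverseʳ 1#)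
    where
    y-a≢0 : y - a ≢ 0#
    y-a≢0 y-a≡0 = y≢a (GroupProps.x∙y⁻¹≈ε⇒x≈y y a y-a≡0)

  -- For a ≠ 0 the constant term 1 - (-a)^(p-1) of the indicator vanishes.
  indicator-expansion : ∀ {a} → a ≢ 0# →
    ∃ λ (c : Fin (p ∸ 1) → F) → ∀ y → indicator a y ≡ ∑[ u < p ∸ 1 ] (c u * y ^ suc (toℕ u))
  indicator-expansion {a} a≢0 = c , λ y → begin
    1# - (y - a) ^ (p ∸ 1)
      ≡⟨ cong (λ z → 1# - z) (binomial (p ∸ 1) y (- a)) ⟩
    1# - (term y Fin.zero + rest y)
      ≡⟨ cong (λ z → 1# - (z + rest y)) (term0 {y}) ⟩
    1# - (1# + rest y)
      ≡⟨ cong (1# +_) (sym (AbelianGroupProps.⁻¹-∙-comm 1# (rest y))) ⟩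
    1# + (- 1# - rest y)
      ≡⟨ MonoidProps.cancelˡ (-‿inverseʳ 1#) (- rest y) ⟩
    - rest y
      ≡⟨ -‿sum (term y ∘ Fin.suc) ⟩
    ∑[ u < p ∸ 1 ] (- term y (Fin.suc u))
      ≡⟨ sum-cong-≗ {p ∸ 1} (λ u → regroup (y ^ suc (toℕ u)) (((p ∸ 1) C suc (toℕ u)) mod p)
                                            ((- a) ^ (p ∸ 1 ∸ suc (toℕ u)))) ⟩
    ∑[ u < p ∸ 1 ] (c u * y ^ suc (toℕ u)) ∎
    where
    open ≡-Reasoning
    term : F → Fin (suc (p ∸ 1)) → F
    term y k = ((p ∸ 1) C toℕ k) mod p * (y ^ toℕ k * (- a) ^ (p ∸ 1 ∸ toℕ k))
    rest : F → F
    rest y = ∑[ u < p ∸ 1 ] term y (Fin.suc u)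
    c : Fin (p ∸ 1) → F
    c u = - (((p ∸ 1) C suc (toℕ u)) mod p * (- a) ^ (p ∸ 1 ∸ suc (toℕ u)))
    term0 : ∀ {y} → term y Fin.zero ≡ 1#
    term0 = begin
      ((p ∸ 1) C 0) mod p * (1# * (- a) ^ (p ∸ 1))
        ≡⟨ cong₂ (λ n z → n mod p * z) (trans (nCk≡nC[n∸k] {0} {p ∸ 1} z≤n) (nCn≡1 (p ∸ 1))) (*-identityˡ _) ⟩
      1# * (- a) ^ (p ∸ 1)                          ≡⟨ *-identityˡ _ ⟩
      (- a) ^ (p ∸ 1)                               ≡⟨ fermat-≢0# (-‿nonzero a≢0) ⟩
      1#                                            ∎
    regroup : ∀ Y b A → - (b * (Y * A)) ≡ - (b * A) * Y
    regroup Y b A = trans (cong -_ (CommSemigroupProps.x∙yz≈xz∙y b Y A)) (RingProps.-‿distribˡ-* (b * A) Y)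

module Polynomials (p : ℕ) .{{_ : NonZero p}} where
  open FF p
  open ModularSums p
  private module CommSemigroupProps = CommutativeSemigroupProperties *-commutativeSemigroup

  monomial : ∀ {n} → Vec ℕ n → (Fin n → F) → F
  monomial e x = prod (λ i → x i ^ Vec.lookup e i)

  evalTerm : ∀ {n} → F × Vec ℕ n → (Fin n → F) → F
  evalTerm (c , e) x = c * monomial e x

  eval : ∀ {n} → Poly n → (Fin n → F) → F
  eval f x = sumList (List.map (λ t → evalTerm t x) f)

  eval-+P : ∀ {n} (f g : Poly n) x → eval (f +P g) x ≡ eval f x + eval g x
  eval-+P f g x = trans (cong sumList (List.map-++ (λ t → evalTerm t x) f g))
    (sumList-++ (List.map (λ t → evalTerm t x) f) (List.map (λ t → evalTerm t x) g))

  monomial-+ : ∀ {n} (e e′ : Vec ℕ n) x → monomial (Vec.zipWith ℕ._+_ e e′) x ≡ monomial e x * monomial e′ x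
  monomial-+ e e′ x = trans
    (Prod.sum-cong-≗ (λ i → trans (cong (x i ^_) (Vec.lookup-zipWith ℕ._+_ i e e′))
                                  (^-homo-* (x i) (Vec.lookup e i) (Vec.lookup e′ i))))
    (Prod.∑-distrib-+ (λ i → x i ^ Vec.lookup e i) (λ i → x i ^ Vec.lookup e′ i))

  eval-*P : ∀ {n} (f g : Poly n) x → eval (f *P g) x ≡ eval f x * eval g x
  eval-*P []            g x = sym (zeroˡ _)
  eval-*P ((c , e) ∷ f) g x = begin
    eval (List.map (λ { (d , e′) → (c * d , Vec.zipWith ℕ._+_ e e′) }) g List.++ (f *P g)) x
      ≡⟨ eval-+P (List.map _ g) (f *P g) x ⟩
    eval (List.map (λ { (d , e′) → (c * d , Vec.zipWith ℕ._+_ e e′) }) g) x + eval (f *P g) x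
      ≡⟨ cong₂ _+_ leading (eval-*P f g x) ⟩
    evalTerm (c , e) x * eval g x + eval f x * eval g x
      ≡⟨ distribʳ (eval g x) (evalTerm (c , e) x) (eval f x) ⟨
    (evalTerm (c , e) x + eval f x) * eval g x ∎
    where
    open ≡-Reasoning
    leading : eval (List.map (λ { (d , e′) → (c * d , Vec.zipWith ℕ._+_ e e′) }) g) x ≡ evalTerm (c , e) x * eval g x
    leading = begin
      sumList (List.map (λ t → evalTerm t x) (List.map _ g))
        ≡⟨ cong sumList (List.map-∘ g) ⟨
      sumList (List.map (λ { (d , e′) → (c * d) * monomial (Vec.zipWith ℕ._+_ e e′) x }) g)
        ≡⟨ cong sumList (List.map-cong (λ { (d , e′) → trans (cong ((c * d) *_) (monomial-+ e e′ x))
                                                         (CommSemigroupProps.interchange c d (monomial e x) (monomial e′ x)) }) g) ⟩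
      sumList (List.map (λ t → evalTerm (c , e) x * evalTerm t x) g)
        ≡⟨ cong sumList (List.map-∘ g) ⟩
      sumList (List.map (evalTerm (c , e) x *_) (List.map (λ t → evalTerm t x) g))
        ≡⟨ *-distribˡ-sumList (evalTerm (c , e) x) (List.map (λ t → evalTerm t x) g) ⟨
      evalTerm (c , e) x * eval g x ∎

  eval-pconst : ∀ {n} c x → eval {n} (pconst c) x ≡ c
  eval-pconst {n} c x = trans (+-identityʳ (c * monomial (Vec.replicate n 0) x))
    (trans (cong (c *_) (prod-one (λ i → x i ^ Vec.lookup (Vec.replicate n 0) i)
                           (λ i → cong (x i ^_) (Vec.lookup-replicate i 0))))
           (*-identityʳ c))

  eval-^P : ∀ {n} (f : Poly n) k x → eval (f ^P k) x ≡ eval f x ^ k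
  eval-^P f zero    x = eval-pconst 1# x
  eval-^P f (suc k) x = trans (eval-*P f (f ^P k) x) (cong (eval f x *_) (eval-^P f k x))

  unitExponent : ∀ {n} → Fin n → Fin n → ℕ
  unitExponent j k = if ⌊ k Fin.≟ j ⌋ then 1 else 0

  unitExponent-≢ : ∀ {n} {j k : Fin n} → k ≢ j → unitExponent j k ≡ 0
  unitExponent-≢ {j = j} {k} k≢j with k Fin.≟ j
  ... | yes k≡j = contradiction k≡j k≢j
  ... | no  _   = refl

  unitExponent-≡ : ∀ {n} (j : Fin n) → unitExponent j j ≡ 1
  unitExponent-≡ j with j Fin.≟ j
  ... | yes _   = refl
  ... | no  j≢j = contradiction refl j≢j

  eval-pvar : ∀ {n} (j : Fin n) x → eval (pvar j) x ≡ x j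
  eval-pvar j x = begin
    1# * monomial (Vec.tabulate (unitExponent j)) x + 0#  ≡⟨ trans (+-identityʳ _) (*-identityˡ _) ⟩
    prod (λ i → x i ^ Vec.lookup (Vec.tabulate (unitExponent j)) i)
      ≡⟨ Prod.sum-cong-≗ (λ i → cong (x i ^_) (Vec.lookup∘tabulate (unitExponent j) i)) ⟩
    prod (λ i → x i ^ unitExponent j i)  ≡⟨ prod-single _ j (λ i i≢j → cong (x i ^_) (unitExponent-≢ i≢j)) ⟩
    x j ^ unitExponent j j               ≡⟨ cong (x j ^_) (unitExponent-≡ j) ⟩
    x j * 1#                             ≡⟨ *-identityʳ (x j) ⟩
    x j                                  ∎
    where open ≡-Reasoning

  eval-scaleP : ∀ {n} c (f : Poly n) x → eval (scaleP c f) x ≡ c * eval f x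
  eval-scaleP c f x = begin
    sumList (List.map (λ t → evalTerm t x) (scaleP c f))
      ≡⟨ cong sumList (List.map-∘ f) ⟨
    sumList (List.map (λ { (d , e) → (c * d) * monomial e x }) f)
      ≡⟨ cong sumList (List.map-cong (λ { (d , e) → *-assoc c d (monomial e x) }) f) ⟩
    sumList (List.map (λ t → c * evalTerm t x) f)
      ≡⟨ cong sumList (List.map-∘ f) ⟩
    sumList (List.map (c *_) (List.map (λ t → evalTerm t x) f))
      ≡⟨ *-distribˡ-sumList c (List.map (λ t → evalTerm t x) f) ⟨
    c * eval f x ∎
    where open ≡-Reasoning

  eval-linP : ∀ {n} (A : Fin n → Fin n → F) i x → eval (linP A i) x ≡ linF A x i
  eval-linP {n} A i x = begin
    eval (List.foldr _+P_ [] (List.map (λ j → scaleP (A i j) (pvar j)) (List.allFin n))) x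
      ≡⟨ eval-foldr (List.map (λ j → scaleP (A i j) (pvar j)) (List.allFin n)) ⟩
    sumList (List.map (λ f → eval f x) (List.map (λ j → scaleP (A i j) (pvar j)) (List.allFin n)))
      ≡⟨ cong sumList (List.map-∘ (List.allFin n)) ⟨
    sumList (List.map (λ j → eval (scaleP (A i j) (pvar j)) x) (List.allFin n))
      ≡⟨ cong sumList (List.map-cong (λ j → trans (eval-scaleP (A i j) (pvar j) x) (cong (A i j *_) (eval-pvar j x)))
                                      (List.allFin n)) ⟩
    linF A x i ∎
    where
    open ≡-Reasoning
    eval-foldr : ∀ fs → eval (List.foldr _+P_ [] fs) x ≡ sumList (List.map (λ f → eval f x) fs)
    eval-foldr []       = refl
    eval-foldr (f ∷ fs) = trans (eval-+P f (List.foldr _+P_ [] fs) x) (cong (eval f x +_) (eval-foldr fs))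

  eval-prodLinP : ∀ {n} (A : Fin n → Fin n → F) r x → eval (prodLinP A r) x ≡ prodLinFn A r x
  eval-prodLinP {n} A r x = go (List.allFin n)
    where
    go : ∀ is → eval (List.foldr _*P_ (pconst 1#) (List.map (λ i → linP A i ^P r i) is)) x ≡
                List.foldr _*_ 1# (List.map (λ i → linF A x i ^F r i) is)
    go []       = eval-pconst 1# x
    go (i ∷ is) = trans (eval-*P (linP A i ^P r i) _ x) (cong₂ _*_
      (trans (eval-^P (linP A i) (r i) x) (trans (cong (_^ r i) (eval-linP A i x)) (sym (^F≡^ (linF A x i) (r i)))))
      (go is))

  degree : ∀ {n} → Vec ℕ n → ℕ
  degree e = ℕ-Sum.sum (Vec.lookup e)

  Homogeneous : ∀ {n} → ℕ → Poly n → Set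
  Homogeneous d f = All (λ t → degree (proj₂ t) ≡ d) f

  degree-+ : ∀ {n} (e e′ : Vec ℕ n) → degree (Vec.zipWith ℕ._+_ e e′) ≡ degree e ℕ.+ degree e′
  degree-+ e e′ = trans (ℕ-Sum.sum-cong-≗ (λ i → Vec.lookup-zipWith ℕ._+_ i e e′))
                        (ℕ-Sum.∑-distrib-+ (Vec.lookup e) (Vec.lookup e′))

  homogeneous-*P : ∀ {n d d′} {f g : Poly n} → Homogeneous d f → Homogeneous d′ g → Homogeneous (d ℕ.+ d′) (f *P g)
  homogeneous-*P hf hg = All.concat⁺ (All.map⁺ (All.map
    (λ {(_ , e)} deg-e → All.map⁺ (All.map (λ {(_ , e′)} deg-e′ → trans (degree-+ e e′) (cong₂ ℕ._+_ deg-e deg-e′)) hg))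
    hf))

  homogeneous-pconst : ∀ {n} c → Homogeneous {n} 0 (pconst c)
  homogeneous-pconst {n} c = ℕ-Sum.sum-zero (Vec.lookup (Vec.replicate n 0)) (λ i → Vec.lookup-replicate i 0) ∷ []

  homogeneous-^P : ∀ {n d} {f : Poly n} k → Homogeneous d f → Homogeneous (k ℕ.* d) (f ^P k)
  homogeneous-^P zero    hf = homogeneous-pconst 1#
  homogeneous-^P (suc k) hf = homogeneous-*P hf (homogeneous-^P k hf)

  homogeneous-linP : ∀ {n} (A : Fin n → Fin n → F) i → Homogeneous 1 (linP A i)
  homogeneous-linP {n} A i = go (List.allFin n)
    where
    degree-unit : ∀ j → degree (Vec.tabulate (unitExponent j)) ≡ 1
    degree-unit j = trans (ℕ-Sum.sum-cong-≗ (Vec.lookup∘tabulate (unitExponent j)))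
      (trans (ℕ-Sum.sum-single (unitExponent j) j (λ k → unitExponent-≢)) (unitExponent-≡ j))
    go : ∀ js → Homogeneous 1 (List.foldr _+P_ [] (List.map (λ j → scaleP (A i j) (pvar j)) js))
    go []       = []
    go (j ∷ js) = degree-unit j ∷ go js

  homogeneous-prodLinP : ∀ {n} (A : Fin n → Fin n → F) r →
    Homogeneous (List.foldr ℕ._+_ 0 (List.map r (List.allFin n))) (prodLinP A r)
  homogeneous-prodLinP {n} A r = go (List.allFin n)
    where
    go : ∀ is → Homogeneous (List.foldr ℕ._+_ 0 (List.map r is))
                            (List.foldr _*P_ (pconst 1#) (List.map (λ i → linP A i ^P r i) is))
    go []       = homogeneous-pconst 1#
    go (i ∷ is) = subst (λ d → Homogeneous (d ℕ.+ List.foldr ℕ._+_ 0 (List.map r is))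
                                           ((linP A i ^P r i) *P
                                            List.foldr _*P_ (pconst 1#) (List.map (λ i → linP A i ^P r i) is)))
                        (ℕ.*-identityʳ (r i))
      (homogeneous-*P (homogeneous-^P (r i) (homogeneous-linP A i)) (go is))

  redExp≤ : ∀ e → redExp e ≤ e
  redExp≤ e = iter≤ e
    where
    redStep≤ : ∀ e → redStep e ≤ e
    redStep≤ e with p ℕ.≤ᵇ e
    ... | true  = ℕ.m∸n≤m e (p ∸ 1)
    ... | false = ℕ.≤-refl
    iter≤ : ∀ k → iter k redStep e ≤ e
    iter≤ zero    = ℕ.≤-refl
    iter≤ (suc k) = ℕ.≤-trans (redStep≤ (iter k redStep e)) (iter≤ k)

  redExp-< : ∀ {e} → e < p → redExp e ≡ e
  redExp-< {e} e<p = iter-id e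
    where
    redStep-id : redStep e ≡ e
    redStep-id with p ℕ.≤ᵇ e in p≤ᵇe
    ... | true  = contradiction (ℕ.≤ᵇ⇒≤ p e (subst T (sym p≤ᵇe) _)) (ℕ.<⇒≱ e<p)
    ... | false = refl
    iter-id : ∀ k → iter k redStep e ≡ e
    iter-id zero    = refl
    iter-id (suc k) = trans (cong redStep (iter-id k)) redStep-id

  lookup-ext : ∀ {A : Set} {n} (u v : Vec A n) → (∀ i → Vec.lookup u i ≡ Vec.lookup v i) → u ≡ v
  lookup-ext u v u≗v = trans (sym (Vec.tabulate∘lookup u)) (trans (Vec.tabulate-cong u≗v) (Vec.tabulate∘lookup v))

  -- Reduction only lowers exponents, so of the terms of degree deg v only x^v itself reduces to x^v.
  Coeff-reduce : ∀ {n} (v : Vec ℕ n) → (∀ i → Vec.lookup v i < p) → (f : Poly n) → Homogeneous (degree v) f →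
    Coeff v (reduce f) ≡ Coeff v f
  Coeff-reduce v v<p []            []               = refl
  Coeff-reduce v v<p ((c , e) ∷ f) (deg-e ∷ hom-f) with Vec.≡-dec ℕ._≟_ (Vec.map redExp e) v | Vec.≡-dec ℕ._≟_ e v
  ... | yes _       | yes _    = cong (c +_) (Coeff-reduce v v<p f hom-f)
  ... | no  _       | no  _    = Coeff-reduce v v<p f hom-f
  ... | no  red-e≢v | yes refl =
    contradiction (lookup-ext _ _ (λ i → trans (Vec.lookup-map i redExp e) (redExp-< (v<p i)))) red-e≢v
  ... | yes red-e≡v | no  e≢v  =
    contradiction (lookup-ext e v (ℕ-sum-≡∧≥⇒≗ (Vec.lookup e) (Vec.lookup v) v≤e deg-e)) e≢v
    where
    v≤e : ∀ i → Vec.lookup v i ≤ Vec.lookup e i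
    v≤e i = subst (_≤ Vec.lookup e i) (trans (sym (Vec.lookup-map i redExp e)) (cong (λ w → Vec.lookup w i) red-e≡v))
                  (redExp≤ (Vec.lookup e i))

module LinearFormProducts (p : ℕ) .{{_ : NonZero p}} (p-prime : Prime p) where
  open FF p
  open PrimeField p p-prime
  open Polynomials p
  private module CommSemigroupProps = CommutativeSemigroupProperties *-commutativeSemigroup

  monoFn≡prod : ∀ {n} (s : Fin n → ℕ) x → monoFn s x ≡ prod (λ i → x i ^ s i)
  monoFn≡prod {n} s x = trans (ΠF≡prod n _) (Prod.sum-cong-≗ (λ i → ^F≡^ (x i) (s i)))

  prodLinFn≡prod : ∀ {n} (A : Fin n → Fin n → F) r x → prodLinFn A r x ≡ prod (λ i → linF A x i ^ r i)
  prodLinFn≡prod {n} A r x = trans (ΠF≡prod n _) (Prod.sum-cong-≗ (λ i → ^F≡^ (linF A x i) (r i)))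

  prodLinFn-cong : ∀ {n} (A : Fin n → Fin n → F) r {x y} → x ≗ y → prodLinFn A r x ≡ prodLinFn A r y
  prodLinFn-cong {n} A r {x} {y} x≗y = begin
    prodLinFn A r x                     ≡⟨ prodLinFn≡prod A r x ⟩
    prod (λ i → linF A x i ^ r i)       ≡⟨ Prod.sum-cong-≗ (λ i → cong (_^ r i) (linF-cong i)) ⟩
    prod (λ i → linF A y i ^ r i)       ≡⟨ prodLinFn≡prod A r y ⟨
    prodLinFn A r y                     ∎
    where
    open ≡-Reasoning
    linF-cong : ∀ i → linF A x i ≡ linF A y i
    linF-cong i = trans (ΣF≡sum n (λ j → A i j * x j))
      (trans (sum-cong-≗ (λ j → cong (A i j *_) (x≗y j))) (sym (ΣF≡sum n (λ j → A i j * y j))))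

  ^-zero : ∀ {a} k → 0 < k → a ≡ 0# → a ^ k ≡ 0#
  ^-zero (suc k) _ refl = zeroˡ _

  inner-vanishes : ∀ {n} (A : Fin n → Fin n → F) → NoGoodPoint A → (r s : Fin n → ℕ) →
    (∀ i → 1 ≤ r i) → (∀ i → 1 ≤ s i) → inner (prodLinFn A r) (monoFn s) ≡ 0#
  inner-vanishes {n} A noGood r s 1≤r 1≤s =
    trans (inner≡sumMaps (prodLinFn A r) (monoFn s)) (sumMaps-zero n _ vanishes-at)
    where
    vanishes-at : ∀ x → prodLinFn A r x * monoFn s x ≡ 0#
    vanishes-at x with Fin.any? (λ i → (x i ≟ 0#) ⊎-dec (linF A x i ≟ 0#))
    ... | yes (i , inj₁ xᵢ≡0) = trans (cong (prodLinFn A r x *_)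
          (trans (monoFn≡prod s x) (prod-zero _ i (^-zero (s i) (1≤s i) xᵢ≡0)))) (zeroʳ (prodLinFn A r x))
    ... | yes (i , inj₂ Axᵢ≡0) = trans (cong (_* monoFn s x)
          (trans (prodLinFn≡prod A r x) (prod-zero _ i (^-zero (r i) (1≤r i) Axᵢ≡0)))) (zeroˡ (monoFn s x))
    ... | no  none = contradiction (x , λ i → (λ xᵢ≡0 → none (i , inj₁ xᵢ≡0)) , (λ Axᵢ≡0 → none (i , inj₂ Axᵢ≡0))) noGood

  noGoodPoint-if-inner-vanishes : ∀ {n} (A : Fin n → Fin n → F) →
    ((r s : Fin n → ℕ) → (∀ i → 1 ≤ r i × r i ≤ p ∸ 1) → (∀ i → 1 ≤ s i × s i ≤ p ∸ 1) →
      inner (prodLinFn A r) (monoFn s) ≡ 0#) →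
    NoGoodPoint A
  noGoodPoint-if-inner-vanishes {n} A inner≡0 (x₀ , good) = sum-g≢0 sum-g≡0
    where
    open ≡-Reasoning
    r : Fin n → ℕ
    r _ = p ∸ 1
    f : (Fin n → F) → F
    f = prodLinFn A r
    δ : (Fin n → F) → F
    δ x = prod (λ i → indicator (x₀ i) (x i))
    g : (Fin n → F) → F
    g x = f x * δ x
    c : Fin n → Fin (p ∸ 1) → F
    c i = proj₁ (indicator-expansion (proj₁ (good i)))
    C : (Fin n → Fin (p ∸ 1)) → F
    C σ = prod (λ i → c i (σ i))
    exponent : (Fin n → Fin (p ∸ 1)) → Fin n → ℕ
    exponent σ i = suc (toℕ (σ i))

    δ-expansion : ∀ x → δ x ≡ sumMaps n (p ∸ 1) (λ σ → C σ * monoFn (exponent σ) x)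
    δ-expansion x = begin
      prod (λ i → indicator (x₀ i) (x i))
        ≡⟨ Prod.sum-cong-≗ (λ i → proj₂ (indicator-expansion (proj₁ (good i))) (x i)) ⟩
      prod (λ i → ∑[ u < p ∸ 1 ] (c i u * x i ^ suc (toℕ u)))
        ≡⟨ prod-sum-distrib n (λ i u → c i u * x i ^ suc (toℕ u)) ⟩
      sumMaps n (p ∸ 1) (λ σ → prod (λ i → c i (σ i) * x i ^ exponent σ i))
        ≡⟨ sumMaps-cong n (λ σ → trans (Prod.∑-distrib-+ (λ i → c i (σ i)) (λ i → x i ^ exponent σ i))
                                        (cong (C σ *_) (sym (monoFn≡prod (exponent σ) x)))) ⟩
      sumMaps n (p ∸ 1) (λ σ → C σ * monoFn (exponent σ) x) ∎

    sum-g≡0 : sumMaps n p g ≡ 0#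
    sum-g≡0 = begin
      sumMaps n p (λ x → f x * δ x)
        ≡⟨ sumMaps-cong n (λ x → trans (cong (f x *_) (δ-expansion x))
                                       (*-distribˡ-sumMaps n (f x) (λ σ → C σ * monoFn (exponent σ) x))) ⟩
      sumMaps n p (λ x → sumMaps n (p ∸ 1) (λ σ → f x * (C σ * monoFn (exponent σ) x)))
        ≡⟨ sumMaps-comm n (λ σ x → f x * (C σ * monoFn (exponent σ) x)) ⟩
      sumMaps n (p ∸ 1) (λ σ → sumMaps n p (λ x → f x * (C σ * monoFn (exponent σ) x)))
        ≡⟨ sumMaps-cong n (λ σ → trans (sumMaps-cong n (λ x → CommSemigroupProps.x∙yz≈y∙xz (f x) (C σ) _))
                                        (sym (*-distribˡ-sumMaps n (C σ) (λ x → f x * monoFn (exponent σ) x)))) ⟩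
      sumMaps n (p ∸ 1) (λ σ → C σ * sumMaps n p (λ x → f x * monoFn (exponent σ) x))
        ≡⟨ sumMaps-zero n _ (λ σ → trans (cong (C σ *_) (trans (sym (inner≡sumMaps f (monoFn (exponent σ))))
                                                                (inner≡0 r (exponent σ) bounds-r (bounds σ))))
                                         (zeroʳ (C σ))) ⟩
      0# ∎
      where
      bounds-r : ∀ i → 1 ≤ r i × r i ≤ p ∸ 1
      bounds-r _ = 0<p-1 , ℕ.≤-refl
      bounds : ∀ σ i → 1 ≤ exponent σ i × exponent σ i ≤ p ∸ 1
      bounds σ i = s≤s z≤n , toℕ<n (σ i)

    sum-g≢0 : sumMaps n p g ≢ 0#
    sum-g≢0 = subst (_≢ 0#) (sym (sumMaps-single n g x₀ g-cong g-off)) (*-nonzero f-x₀≢0 δ-x₀≢0)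
      where
      g-cong : ∀ {x y} → x ≗ y → g x ≡ g y
      g-cong x≗y = cong₂ _*_ (prodLinFn-cong A r x≗y) (Prod.sum-cong-≗ (λ i → cong (indicator (x₀ i)) (x≗y i)))
      g-off : ∀ x i → x i ≢ x₀ i → g x ≡ 0#
      g-off x i xᵢ≢x₀ᵢ = trans (cong (f x *_) (prod-zero _ i (indicator-off xᵢ≢x₀ᵢ))) (zeroʳ (f x))
      f-x₀≢0 : f x₀ ≢ 0#
      f-x₀≢0 = subst (_≢ 0#) (sym (prodLinFn≡prod A r x₀))
        (prod-nonzero (λ i → linF A x₀ i ^ r i) (λ i → ^-nonzero (r i) (proj₂ (good i))))
      δ-x₀≢0 : δ x₀ ≢ 0#
      δ-x₀≢0 = subst (_≢ 0#) (sym (prod-one _ (λ i → indicator-diag (x₀ i)))) 1#≢0#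

  sumMaps-monomial : ∀ {n} (k : Fin n → ℕ) → sumMaps n p (λ x → prod (λ i → x i ^ k i)) ≡ prod (λ i → powerSum (k i))
  sumMaps-monomial {n} k = sym (prod-sum-distrib n (λ i a → a ^ k i))

  module CoefficientExtraction {n} (v : Vec ℕ n) (v≤p-2 : ∀ i → Vec.lookup v i ≤ p ∸ 2) where

    v<p-1 : ∀ i → Vec.lookup v i < p ∸ 1
    v<p-1 i = ℕ.≤-<-trans (v≤p-2 i) (ℕ.∸-monoʳ-< {p} {2} {1} ℕ.≤-refl 1<p)

    v<p : ∀ i → Vec.lookup v i < p
    v<p i = ℕ.<-trans (v<p-1 i) p-1<p

    t : Fin n → ℕ
    t i = p ∸ 1 ∸ Vec.lookup v i

    t+v≡p-1 : ∀ i → t i ℕ.+ Vec.lookup v i ≡ p ∸ 1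
    t+v≡p-1 i = ℕ.m∸n+n≡m (ℕ.<⇒≤ (v<p-1 i))

    t-bounds : ∀ i → 1 ≤ t i × t i ≤ p ∸ 1
    t-bounds i = ℕ.m<n⇒0<n∸m (v<p-1 i) , ℕ.m∸n≤m (p ∸ 1) (Vec.lookup v i)

    K : F
    K = prod (λ (_ : Fin n) → powerSum (p ∸ 1))

    K≢0 : K ≢ 0#
    K≢0 = prod-nonzero {n} (λ _ → powerSum (p ∸ 1)) (λ _ → subst (_≢ 0#) (sym powerSum-top) (-‿nonzero 1#≢0#))

    W : Vec ℕ n → F
    W e = prod (λ i → powerSum (t i ℕ.+ Vec.lookup e i))

    W-diag : W v ≡ K
    W-diag = Prod.sum-cong-≗ {n} (λ i → cong powerSum (t+v≡p-1 i))

    W-off : ∀ e → degree e ≡ degree v → e ≢ v → W e ≡ 0#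
    W-off e deg-e≡ e≢v with Fin.all? (λ i → Vec.lookup v i ℕ.≤? Vec.lookup e i)
    ... | yes v≤e = contradiction (lookup-ext e v (ℕ-sum-≡∧≥⇒≗ (Vec.lookup e) (Vec.lookup v) v≤e deg-e≡)) e≢v
    ... | no  v≰e with Fin.¬∀⟶∃¬ n _ (λ i → Vec.lookup v i ℕ.≤? Vec.lookup e i) v≰e
    ...   | i , vᵢ≰eᵢ = prod-zero _ i (powerSum-vanishes _ (ℕ.≤-<-trans t+e<t+v (subst (_< p) (sym (t+v≡p-1 i)) p-1<p)))
      where
      t+e<t+v : t i ℕ.+ Vec.lookup e i < t i ℕ.+ Vec.lookup v i
      t+e<t+v = ℕ.+-monoʳ-< (t i) (ℕ.≰⇒> vᵢ≰eᵢ)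

    sumMaps-term : ∀ c e → sumMaps n p (λ x → monoFn t x * evalTerm (c , e) x) ≡ c * W e
    sumMaps-term c e = begin
      sumMaps n p (λ x → monoFn t x * (c * monomial e x))
        ≡⟨ sumMaps-cong n (λ x → trans (CommSemigroupProps.x∙yz≈y∙xz (monoFn t x) c (monomial e x)) (cong (c *_) (combine x))) ⟩
      sumMaps n p (λ x → c * prod (λ i → x i ^ (t i ℕ.+ Vec.lookup e i)))
        ≡⟨ *-distribˡ-sumMaps n c (λ x → prod (λ i → x i ^ (t i ℕ.+ Vec.lookup e i))) ⟨
      c * sumMaps n p (λ x → prod (λ i → x i ^ (t i ℕ.+ Vec.lookup e i)))
        ≡⟨ cong (c *_) (sumMaps-monomial (λ i → t i ℕ.+ Vec.lookup e i)) ⟩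
      c * W e ∎
      where
      open ≡-Reasoning
      combine : ∀ x → monoFn t x * monomial e x ≡ prod (λ i → x i ^ (t i ℕ.+ Vec.lookup e i))
      combine x = trans (cong (_* monomial e x) (monoFn≡prod t x))
        (trans (sym (Prod.∑-distrib-+ (λ i → x i ^ t i) (λ i → x i ^ Vec.lookup e i)))
               (Prod.sum-cong-≗ (λ i → sym (^-homo-* (x i) (t i) (Vec.lookup e i)))))

    sum-terms : ∀ f → Homogeneous (degree v) f → sumList (List.map (λ τ → proj₁ τ * W (proj₂ τ)) f) ≡ Coeff v f * K
    sum-terms []            []              = sym (zeroˡ K)
    sum-terms ((c , e) ∷ f) (deg-e ∷ hom-f) with Vec.≡-dec ℕ._≟_ e v
    ... | yes refl = trans (cong₂ _+_ (cong (c *_) W-diag) (sum-terms f hom-f)) (sym (distribʳ K c (Coeff v f)))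
    ... | no  e≢v  = trans (cong₂ _+_ (trans (cong (c *_) (W-off e deg-e e≢v)) (zeroʳ c)) (sum-terms f hom-f))
                           (+-identityˡ (Coeff v f * K))

    inner-extracts-Coeff : ∀ f → Homogeneous (degree v) f → sumMaps n p (λ x → eval f x * monoFn t x) ≡ Coeff v f * K
    inner-extracts-Coeff f hom-f = begin
      sumMaps n p (λ x → eval f x * monoFn t x)
        ≡⟨ sumMaps-cong n (λ x → trans (*-comm (eval f x) (monoFn t x))
             (trans (*-distribˡ-sumList (monoFn t x) (List.map (λ τ → evalTerm τ x) f)) (cong sumList (sym (List.map-∘ f))))) ⟩
      sumMaps n p (λ x → sumList (List.map (λ τ → monoFn t x * evalTerm τ x) f))
        ≡⟨ sumMaps-foldr n (λ τ x → monoFn t x * evalTerm τ x) f ⟩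
      sumList (List.map (λ τ → sumMaps n p (λ x → monoFn t x * evalTerm τ x)) f)
        ≡⟨ cong sumList (List.map-cong (λ { (c , e) → sumMaps-term c e }) f) ⟩
      sumList (List.map (λ τ → proj₁ τ * W (proj₂ τ)) f)
        ≡⟨ sum-terms f hom-f ⟩
      Coeff v f * K ∎
      where open ≡-Reasoning

  Coeff-vanishes : ∀ {n} (A : Fin n → Fin n → F) → NoGoodPoint A → (r s′ : Fin n → ℕ) →
    (∀ i → 1 ≤ r i) → (∀ i → s′ i ≤ p ∸ 2) →
    List.foldr ℕ._+_ 0 (List.map r (List.allFin n)) ≡ List.foldr ℕ._+_ 0 (List.map s′ (List.allFin n)) →
    Coeff (Vec.tabulate s′) (reduce (prodLinP A r)) ≡ 0#
  Coeff-vanishes {n} A noGood r s′ 1≤r s′≤p-2 Σr≡Σs′ = begin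
    Coeff v (reduce f)  ≡⟨ Coeff-reduce v v<p f hom-f ⟩
    Coeff v f           ≡⟨ x≢0∧x*y≡0⇒y≡0 (Coeff v f) K≢0 (trans (*-comm K (Coeff v f)) Coeff*K≡0) ⟩
    0#                  ∎
    where
    open ≡-Reasoning
    v : Vec ℕ n
    v = Vec.tabulate s′
    open CoefficientExtraction v (λ i → subst (_≤ p ∸ 2) (sym (Vec.lookup∘tabulate s′ i)) (s′≤p-2 i))
    f : Poly n
    f = prodLinP A r
    hom-f : Homogeneous (degree v) f
    hom-f = subst (λ d → Homogeneous d f)
      (trans Σr≡Σs′ (trans (foldr-map-allFin ℕ._+_ 0 s′) (sym (ℕ-Sum.sum-cong-≗ (Vec.lookup∘tabulate s′)))))
      (homogeneous-prodLinP A r)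
    Coeff*K≡0 : Coeff v f * K ≡ 0#
    Coeff*K≡0 = begin
      Coeff v f * K                                       ≡⟨ inner-extracts-Coeff f hom-f ⟨
      sumMaps n p (λ x → eval f x * monoFn t x)           ≡⟨ sumMaps-cong n (λ x → cong (_* monoFn t x) (eval-prodLinP A r x)) ⟩
      sumMaps n p (λ x → prodLinFn A r x * monoFn t x)    ≡⟨ inner≡sumMaps (prodLinFn A r) (monoFn t) ⟨
      inner (prodLinFn A r) (monoFn t)                    ≡⟨ inner-vanishes A noGood r t 1≤r (proj₁ ∘ t-bounds) ⟩
      0#                                                  ∎

open import Data.List using (map; allFin)
open import Data.Nat.ListAction using (sum)

lemma8 : (p : ℕ) .{{_ : NonZero p}} → Prime p → 3 < p → (n : ℕ) → 1 ≤ n →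
    (A : Fin n → Fin n → FF.F p) → FF.Nonsingular p A →
    (FF.NoGoodPoint p A ⇔
      ((r s : Fin n → ℕ) → ((i : Fin n) → 1 ≤ r i × r i ≤ p ∸ 1) →
        ((i : Fin n) → 1 ≤ s i × s i ≤ p ∸ 1) →
        FF.inner p (FF.prodLinFn p A r) (FF.monoFn p s) ≡ FF.0F p))
    × (FF.NoGoodPoint p A → (r s′ : Fin n → ℕ) → ((i : Fin n) → 1 ≤ r i × r i ≤ p ∸ 1) →
        ((i : Fin n) → s′ i ≤ p ∸ 2) →
        sum (map r (allFin n)) ≡ sum (map s′ (allFin n)) →
        FF.Coeff p (tabulate s′) (FF.reduce p (FF.prodLinP p A r)) ≡ FF.0F p)
lemma8 p p-prime _ n _ A _ =
  mk⇔ (λ noGood r s r-bounds s-bounds → inner-vanishes A noGood r s (proj₁ ∘ r-bounds) (proj₁ ∘ s-bounds))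
      (noGoodPoint-if-inner-vanishes A) ,
  λ noGood r s′ r-bounds → Coeff-vanishes A noGood r s′ (proj₁ ∘ r-bounds)
  where open LinearFormProducts p p-prime
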